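{- Let $L\subseteq\{0,1\}^*$ be a 0-1-symmetric language. Then $\mathcal{G}_L$ is closed under adding some twins: for every $G=(V,E)\in\mathcal{G}_L$, every $v\in V$ and every new vertex $v'\notin V$, at least one of the following holds: (i) the graph obtained from $G$ by adding $v'$ as a true twin of $v$ (i.e., $v'$ adjacent to $v$ and to exactly the neighbors of $v$) belongs to $\mathcal{G}_L$; (ii) the graph obtained from $G$ by adding $v'$ as a false twin of $v$ (i.e., $v'$ adjacent to exactly the neighbors of $v$ but not to $v$) belongs to $\mathcal{G}_L$.
   Context: All graphs are finite, simple, undirected, with nonempty vertex sets, and graph classes are considered up to isomorphism. For $w\in\{0,1\}^*$ let $\widetilde{w}$ be obtained from $w$ by exchanging the letters 0 and 1; a language $L\subseteq\{0,1\}^*$ is 0-1-symmetric if $L=\{\widetilde w : w\in L\}$. For an alphabet $V$ and distinct $u,v\in V$, $h_{u,v}:V^*\to\{0,1\}^*$ is the monoid morphism with $u\mapsto 0$, $v\mapsto 1$ and $x\mapsto\lambda$ (empty word) for all other letters $x$. For a 0-1-symmetric $L$ and a nonempty word $w$ whose set of occurring letters is $V$, $G(L,w)$ is the graph with vertex set $V$ in which distinct $u,v$ are adjacent iff $h_{u,v}(w)\in L$. A graph is $L$-representable if it is isomorphic to some $G(L,w)$, and $\mathcal{G}_L$ denotes the class of all $L$-representable graphs. -}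

module Defs where

open import Data.Bool using (Bool; true; false; not; if_then_else_)
open import Data.Nat using (ℕ; suc; _≤_; s≤s; z≤n)
open import Data.Fin using (Fin; zero; suc; _≟_)
open import Data.List using (List; []; _∷_; map)
open import Data.List.Membership.Propositional using (_∈_)
open import Data.Product using (Σ; ∃; _×_; _,_)
open import Relation.Nullary using (yes; no; ¬_)
open import Relation.Binary.PropositionalEquality
open import Function.Bundles using (_↔_; Inverse)
open import Data.Empty using (⊥-elim)

-- A language L ⊆ {0,1}^* is given by its characteristic function
-- (letter 0 = false, letter 1 = true).
Language : Set
Language = List Bool → Bool

swap01 : List Bool → List Bool
swap01 = map not

Symmetric01 : Language → Set
Symmetric01 L = ∀ w → L (swap01 w) ≡ L w

h : ∀ {m} → Fin m → Fin m → List (Fin m) → List Bool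
h u v [] = []
h u v (x ∷ w) with x ≟ u | x ≟ v
... | yes _ | _     = false ∷ h u v w
... | no _  | yes _ = true ∷ h u v w
... | no _  | no _  = h u v w

h-swap : ∀ {m} (u v : Fin m) → ¬ (u ≡ v) → ∀ w → h v u w ≡ swap01 (h u v w)
h-swap u v u≢v [] = refl
h-swap u v u≢v (x ∷ w) with x ≟ u | x ≟ v
... | yes refl | yes refl = ⊥-elim (u≢v refl)
... | yes refl | no _  = cong (true ∷_) (h-swap u v u≢v w)
... | no _  | yes refl = cong (false ∷_) (h-swap u v u≢v w)
... | no _  | no _  = h-swap u v u≢v w

record Graph : Set where
  field
    size     : ℕ
    nonempty : 1 ≤ size
    adj      : Fin size → Fin size → Bool
    adj-sym  : ∀ x y → adj x y ≡ adj y x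
    adj-irr  : ∀ x → adj x x ≡ false
open Graph public

record _≅_ (G H : Graph) : Set where
  field
    bij      : Fin (size G) ↔ Fin (size H)
    preserve : ∀ x y → adj G x y ≡ adj H (Inverse.to bij x) (Inverse.to bij y)

adjLw : ∀ {m} → Language → List (Fin m) → Fin m → Fin m → Bool
adjLw L w u v with u ≟ v
... | yes _ = false
... | no _  = L (h u v w)

adjLw-sym : ∀ {m} (L : Language) → Symmetric01 L → (w : List (Fin m)) →
            ∀ u v → adjLw L w u v ≡ adjLw L w v u
adjLw-sym L sL w u v with u ≟ v | v ≟ u
... | yes _ | yes _ = refl
... | yes p | no q = ⊥-elim (q (sym p))
... | no p | yes q = ⊥-elim (p (sym q))
... | no p | no _ = trans (sym (sL (h u v w))) (cong L (sym (h-swap u v p w)))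

adjLw-irr : ∀ {m} (L : Language) (w : List (Fin m)) → ∀ u → adjLw L w u u ≡ false
adjLw-irr L w u with u ≟ u
... | yes _ = refl
... | no p = ⊥-elim (p refl)

nonemptyAlphabet : ∀ {m} (w : List (Fin m)) → ¬ (w ≡ []) → 1 ≤ m
nonemptyAlphabet [] ne = ⊥-elim (ne refl)
nonemptyAlphabet (zero ∷ _) _ = s≤s z≤n
nonemptyAlphabet (suc _ ∷ _) _ = s≤s z≤n

GLw : (L : Language) → Symmetric01 L → ∀ {m} (w : List (Fin m)) → ¬ (w ≡ []) → Graph
GLw L sL {m} w ne = record
  { size = m ; nonempty = nonemptyAlphabet w ne ; adj = adjLw L w
  ; adj-sym = adjLw-sym L sL w ; adj-irr = adjLw-irr L w }

Representable : (L : Language) → Symmetric01 L → Graph → Set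
Representable L sL G =
  Σ ℕ λ m → Σ (List (Fin m)) λ w → Σ (¬ (w ≡ [])) λ ne →
    ((x : Fin m) → x ∈ w) × (G ≅ GLw L sL w ne)

-- Adding a new vertex (zero; old vertices are suc x) as a twin of v.
-- b = true: true twin (adjacent to v), b = false: false twin.
-- adjacency between the new vertex and an old vertex y
newAdj : (G : Graph) → Fin (size G) → Bool → Fin (size G) → Bool
newAdj G v b y with y ≟ v
... | yes _ = b
... | no _  = adj G v y

twinAdj : (G : Graph) → Fin (size G) → Bool → Fin (suc (size G)) → Fin (suc (size G)) → Bool
twinAdj G v b zero zero = false
twinAdj G v b zero (suc y) = newAdj G v b y
twinAdj G v b (suc x) zero = newAdj G v b x
twinAdj G v b (suc x) (suc y) = adj G x y

twinAdj-sym : (G : Graph) (v : Fin (size G)) (b : Bool) → ∀ x y → twinAdj G v b x y ≡ twinAdj G v b y x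
twinAdj-sym G v b zero zero = refl
twinAdj-sym G v b zero (suc y) = refl
twinAdj-sym G v b (suc x) zero = refl
twinAdj-sym G v b (suc x) (suc y) = adj-sym G x y

twinAdj-irr : (G : Graph) (v : Fin (size G)) (b : Bool) → ∀ x → twinAdj G v b x x ≡ false
twinAdj-irr G v b zero = refl
twinAdj-irr G v b (suc x) = adj-irr G x

addTwin : (G : Graph) → Fin (size G) → Bool → Graph
addTwin G v b = record
  { size = suc (size G) ; nonempty = s≤s z≤n ; adj = twinAdj G v b
  ; adj-sym = twinAdj-sym G v b ; adj-irr = twinAdj-irr G v b }

addTrueTwin : (G : Graph) → Fin (size G) → Graph
addTrueTwin G v = addTwin G v true

addFalseTwin : (G : Graph) → Fin (size G) → Graph
addFalseTwin G v = addTwin G v false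

{-# OPTIONS --safe #-}
-- If a is the letter of w representing v, insert a fresh letter a' right after
-- every occurrence of a.  Erasing a' gives back w, and in the projection onto
-- {a', y} the letter a' merely takes the place of a, so a' is a twin of a in the
-- graph of the new word.  Whether it is a true or a false twin is decided by
-- whether the projection onto {a', a} lies in L, which we do not control.
module Submission where

open import Defs
open import Data.Bool using (Bool; true; false)
open import Data.Empty using (⊥-elim)
open import Data.Fin using (Fin; zero; suc; _≟_)
open import Data.Fin.Permutation using (lift₀)
open import Data.List using (List; []; _∷_; _++_; map; concatMap)
open import Data.List.Membership.Propositional using (_∈_)
open import Data.List.Membership.Propositional.Properties using (∈-concatMap⁺)
open import Data.List.Relation.Unary.Any using (here; there)
import Data.List.Relation.Unary.Any as Any
open import Data.List.Relation.Unary.Any.Properties using (¬Any[])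
open import Data.Nat using (ℕ; suc)
open import Data.Product using (Σ; _,_)
open import Data.Sum using (_⊎_; inj₁; inj₂)
open import Function.Bundles using (Inverse; Injection)
open import Function.Construct.Composition using (_↔-∘_)
open import Function.Construct.Identity using (↔-id)
open import Function.Properties.Inverse using (↔⇒↣)
open import Relation.Binary.PropositionalEquality
open import Relation.Nullary using (yes; no; ¬_)

private variable
  m n : ℕ

≅-trans : {G H K : Graph} → G ≅ H → H ≅ K → G ≅ K
≅-trans G≅H H≅K = record
  { bij      = _≅_.bij H≅K ↔-∘ _≅_.bij G≅H
  ; preserve = λ x y → trans (_≅_.preserve G≅H x y) (_≅_.preserve H≅K _ _)
  }

addTwin-≅ : {G H : Graph} (G≅H : G ≅ H) (v : Fin (size G)) (b : Bool) →
            addTwin G v b ≅ addTwin H (Inverse.to (_≅_.bij G≅H) v) b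
addTwin-≅ {G} {H} G≅H v b = record { bij = lift₀ bij ; preserve = twinAdj-preserved }
  where
  open _≅_ G≅H using (bij; preserve)
  open Inverse bij using (to)

  newAdj-preserved : ∀ y → newAdj G v b y ≡ newAdj H (to v) b (to y)
  newAdj-preserved y with y ≟ v | to y ≟ to v
  ... | yes _    | yes _ = refl
  ... | yes refl | no ne = ⊥-elim (ne refl)
  ... | no ne    | yes e = ⊥-elim (ne (Injection.injective (↔⇒↣ bij) e))
  ... | no _     | no _  = preserve v y

  twinAdj-preserved : ∀ x y → twinAdj G v b x y
                              ≡ twinAdj H (to v) b (Inverse.to (lift₀ bij) x) (Inverse.to (lift₀ bij) y)
  twinAdj-preserved zero    zero    = refl
  twinAdj-preserved zero    (suc y) = newAdj-preserved y
  twinAdj-preserved (suc x) zero    = newAdj-preserved x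
  twinAdj-preserved (suc x) (suc y) = preserve x y

h-++ : (u v : Fin m) (xs ys : List (Fin m)) → h u v (xs ++ ys) ≡ h u v xs ++ h u v ys
h-++ u v [] ys = refl
h-++ u v (x ∷ xs) ys with x ≟ u | x ≟ v
... | yes _ | _     = cong (false ∷_) (h-++ u v xs ys)
... | no _  | yes _ = cong (true ∷_) (h-++ u v xs ys)
... | no _  | no _  = h-++ u v xs ys

h-concatMap : (σ : Fin m → List (Fin n)) {u v : Fin m} {u′ v′ : Fin n} →
              (∀ z → h u′ v′ (σ z) ≡ h u v (z ∷ [])) →
              ∀ w → h u′ v′ (concatMap σ w) ≡ h u v w
h-concatMap σ hσ [] = refl
h-concatMap σ {u} {v} {u′} {v′} hσ (z ∷ w) = begin
  h u′ v′ (σ z ++ concatMap σ w)             ≡⟨ h-++ u′ v′ (σ z) (concatMap σ w) ⟩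
  h u′ v′ (σ z) ++ h u′ v′ (concatMap σ w)   ≡⟨ cong₂ _++_ (hσ z) (h-concatMap σ hσ w) ⟩
  h u v (z ∷ []) ++ h u v w                 ≡⟨ h-++ u v (z ∷ []) w ⟨
  h u v (z ∷ w)                             ∎
  where open ≡-Reasoning

-- suc z ≟ suc x computes from z ≟ x, so abstracting z ≟ x also unfolds h on the left.
h-map-suc : (x y : Fin m) (w : List (Fin m)) → h (suc x) (suc y) (map suc w) ≡ h x y w
h-map-suc x y [] = refl
h-map-suc x y (z ∷ w) with z ≟ x | z ≟ y
... | yes _ | _     = cong (false ∷_) (h-map-suc x y w)
... | no _  | yes _ = cong (true ∷_) (h-map-suc x y w)
... | no _  | no _  = h-map-suc x y w

-- As in addTwin, the fresh letter is zero and an old letter x becomes suc x.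
duplicateLetter : Fin m → Fin m → List (Fin (suc m))
duplicateLetter a z with z ≟ a
... | yes _ = suc z ∷ zero ∷ []
... | no _  = suc z ∷ []

duplicate : Fin m → List (Fin m) → List (Fin (suc m))
duplicate a = concatMap (duplicateLetter a)

h-duplicateLetter-suc : (a x y z : Fin m) → h (suc x) (suc y) (duplicateLetter a z) ≡ h x y (z ∷ [])
h-duplicateLetter-suc a x y z with z ≟ a
h-duplicateLetter-suc a x y z | no _ = h-map-suc x y (z ∷ [])
h-duplicateLetter-suc a x y z | yes _ with z ≟ x | z ≟ y
... | yes _ | _     = refl
... | no _  | yes _ = refl
... | no _  | no _  = refl

h-duplicateLetter-zero : (a y z : Fin m) → ¬ y ≡ a → h zero (suc y) (duplicateLetter a z) ≡ h a y (z ∷ [])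
h-duplicateLetter-zero a y z y≢a with z ≟ a
h-duplicateLetter-zero a y z y≢a | yes refl with z ≟ z | z ≟ y
... | yes _   | yes refl = ⊥-elim (y≢a refl)
... | yes _   | no _     = refl
... | no z≢z  | _        = ⊥-elim (z≢z refl)
h-duplicateLetter-zero a y z y≢a | no z≢a with z ≟ a | z ≟ y
... | yes z≡a | _     = ⊥-elim (z≢a z≡a)
... | no _    | yes _ = refl
... | no _    | no _  = refl

∈-duplicate : {a x : Fin m} {y : Fin (suc m)} {w : List (Fin m)} →
              x ∈ w → y ∈ duplicateLetter a x → y ∈ duplicate a w
∈-duplicate {a = a} x∈w y∈ = ∈-concatMap⁺ (duplicateLetter a) (Any.map (λ { refl → y∈ }) x∈w)

suc-∈-duplicateLetter : (a z : Fin m) → suc z ∈ duplicateLetter a z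
suc-∈-duplicateLetter a z with z ≟ a
... | yes _ = here refl
... | no _  = here refl

zero-∈-duplicateLetter : (a : Fin m) → zero ∈ duplicateLetter a a
zero-∈-duplicateLetter a with a ≟ a
... | yes _   = there (here refl)
... | no a≢a  = ⊥-elim (a≢a refl)

module _ (L : Language) where

  adjLw-duplicate-suc : (a : Fin m) (w : List (Fin m)) (x y : Fin m) →
                        adjLw L (duplicate a w) (suc x) (suc y) ≡ adjLw L w x y
  adjLw-duplicate-suc a w x y with x ≟ y
  ... | yes _ = refl
  ... | no _  = cong L (h-concatMap (duplicateLetter a) (h-duplicateLetter-suc a x y) w)

  adjLw-duplicate-zero : (a : Fin m) (w : List (Fin m)) (y : Fin m) → ¬ y ≡ a →
                         adjLw L (duplicate a w) zero (suc y) ≡ adjLw L w a y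
  adjLw-duplicate-zero a w y y≢a with a ≟ y
  ... | yes a≡y = ⊥-elim (y≢a (sym a≡y))
  ... | no _    = cong L (h-concatMap (duplicateLetter a) (λ z → h-duplicateLetter-zero a y z y≢a) w)

module _ (L : Language) (sL : Symmetric01 L) where

  addTwin-≅-duplicate : (a : Fin m) (w : List (Fin m)) (ne : ¬ w ≡ []) (ne′ : ¬ duplicate a w ≡ []) →
    addTwin (GLw L sL w ne) a (L (h zero (suc a) (duplicate a w))) ≅ GLw L sL (duplicate a w) ne′
  addTwin-≅-duplicate a w ne ne′ = record { bij = ↔-id _ ; preserve = preserve }
    where
    newAdj-duplicate : ∀ y → newAdj (GLw L sL w ne) a (L (h zero (suc a) (duplicate a w))) y
                             ≡ adjLw L (duplicate a w) zero (suc y)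
    newAdj-duplicate y with y ≟ a
    ... | yes refl = refl
    ... | no y≢a   = sym (adjLw-duplicate-zero L a w y y≢a)

    preserve : ∀ x y → twinAdj (GLw L sL w ne) a (L (h zero (suc a) (duplicate a w))) x y
                       ≡ adjLw L (duplicate a w) x y
    preserve zero    zero    = refl
    preserve zero    (suc y) = newAdj-duplicate y
    preserve (suc x) zero    = trans (newAdj-duplicate x) (adjLw-sym L sL (duplicate a w) zero (suc x))
    preserve (suc x) (suc y) = sym (adjLw-duplicate-suc L a w x y)

  duplicate-representable : (w : List (Fin m)) (ne : ¬ w ≡ []) → (∀ x → x ∈ w) → (a : Fin m) →
    Representable L sL (addTwin (GLw L sL w ne) a (L (h zero (suc a) (duplicate a w))))
  duplicate-representable {m} w ne all a =
    suc m , duplicate a w , ne′ , all′ , addTwin-≅-duplicate a w ne ne′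
    where
    all′ : (x : Fin (suc m)) → x ∈ duplicate a w
    all′ zero    = ∈-duplicate (all a) (zero-∈-duplicateLetter a)
    all′ (suc x) = ∈-duplicate (all x) (suc-∈-duplicateLetter a x)

    ne′ : ¬ duplicate a w ≡ []
    ne′ e = ¬Any[] (subst (zero ∈_) e (all′ zero))

  Representable-≅ : {G H : Graph} → G ≅ H → Representable L sL H → Representable L sL G
  Representable-≅ G≅H (m , w , ne , all , H≅GLw) = m , w , ne , all , ≅-trans G≅H H≅GLw

  addTwin-representable : {G : Graph} → Representable L sL G → (v : Fin (size G)) →
                          Σ Bool λ b → Representable L sL (addTwin G v b)
  addTwin-representable (m , w , ne , all , G≅GLw) v =
    _ , Representable-≅ (addTwin-≅ G≅GLw v _) (duplicate-representable w ne all (Inverse.to (_≅_.bij G≅GLw) v))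

mainTheorem2 : (L : Language) (sL : Symmetric01 L) (G : Graph) →
    Representable L sL G → (v : Fin (size G)) →
    Representable L sL (addTrueTwin G v) ⊎ Representable L sL (addFalseTwin G v)
mainTheorem2 L sL G rep v with addTwin-representable L sL rep v
... | true  , twinRep = inj₁ twinRep
... | false , twinRep = inj₂ twinRep
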